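{- Let $\lambda,\mu,\nu\vdash n$ with $\ell(\lambda)=\ell$, $\ell(\mu)=m$, $\ell(\nu)=r$, and suppose $\ell m r=o(n)$ as $n\to\infty$. Then $$g(\lambda,\mu,\nu)\le\exp\big[\ell m r\log n+O(\ell m r)\big].$$
   Context: $\ell(\cdot)$ is number of parts. The Kronecker coefficient is $g(\lambda,\mu,\nu)=\frac{1}{n!}\sum_{\sigma\in S_n}\chi^\lambda(\sigma)\chi^\mu(\sigma)\chi^\nu(\sigma)$, with $\chi^\lambda$ the irreducible $S_n$-character indexed by $\lambda$. The asymptotic statement refers to any sequence of such triples with $n\to\infty$ and $\ell m r/n\to0$; the implied constant in $O(\cdot)$ is uniform. -}

module Defs where

open import Data.Bool using (Bool; true; false; if_then_else_; _∧_)
open import Data.Nat using (ℕ; zero; suc; _+_; _*_; _∸_; _≤_; _<_; _≡ᵇ_; _≤ᵇ_; _<ᵇ_; _!)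
open import Data.Nat.Properties using (_!≢0)
open import Data.Nat.ListAction using (sum)
open import Data.List using (List; []; _∷_; map; concatMap; length; upTo; foldr; filter)
open import Data.Integer using (ℤ; +_; -_)
import Data.Integer as ℤ
open import Data.Rational using (ℚ; _/_)
open import Data.Product using (_×_)
open import Data.List.Relation.Unary.All using (All)
open import Relation.Binary.PropositionalEquality using (_≡_)

data Decreasing : List ℕ → Set where
  []  : Decreasing []
  [_] : ∀ x → Decreasing (x ∷ [])
  _∷_ : ∀ {x y ys} → y ≤ x → Decreasing (y ∷ ys) → Decreasing (x ∷ y ∷ ys)

IsPartition : ℕ → List ℕ → Set
IsPartition n λ′ = Decreasing λ′ × All (λ x → 1 ≤ x) λ′ × sum λ′ ≡ n

elemᵇ : ℕ → List ℕ → Bool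
elemᵇ x []       = false
elemᵇ x (y ∷ ys) = if x ≡ᵇ y then true else elemᵇ x ys

allᵇ : (ℕ → Bool) → List ℕ → Bool
allᵇ p []       = true
allᵇ p (x ∷ xs) = p x ∧ allᵇ p xs

at : List ℕ → ℕ → ℕ
at []       _       = 0
at (x ∷ xs) zero    = x
at (x ∷ xs) (suc i) = at xs i

sumℤ : List ℤ → ℤ
sumℤ = foldr ℤ._+_ (+ 0)

-- The symmetric group S_n: all permutations of [0,…,n-1], each given
-- in one-line notation as the list (σ 0, …, σ (n-1)).

insertions : ℕ → List ℕ → List (List ℕ)
insertions x []       = (x ∷ []) ∷ []
insertions x (y ∷ ys) = (x ∷ y ∷ ys) ∷ map (y ∷_) (insertions x ys)

perms : List ℕ → List (List ℕ)
perms []       = [] ∷ []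
perms (x ∷ xs) = concatMap (insertions x) (perms xs)

Sym : ℕ → List (List ℕ)
Sym n = perms (upTo n)

orbit : ℕ → List ℕ → ℕ → ℕ → List ℕ
orbit zero    σ i c = []
orbit (suc f) σ i c with at σ c
... | d = d ∷ (if d ≡ᵇ i then [] else orbit f σ i d)

-- cycle type of σ ∈ S_n: one entry (the cycle length) per cycle,
-- recorded at the least element of the cycle
cycleType : ℕ → List ℕ → List ℕ
cycleType n σ = concatMap cyc (upTo n)
  where
  cyc : ℕ → List ℕ
  cyc i with orbit n σ i i
  ... | o = if allᵇ (i ≤ᵇ_) o then length o ∷ [] else []

-- Irreducible characters χ^λ of S_n, via the Murnaghan–Nakayama rule
-- in β-number (abacus) form.  Removing a rim hook of size r corresponds to
-- replacing some b ∈ β with b - r ∉ β (b ≥ r), with sign (-1)^h where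
-- h = #{c ∈ β : b - r < c < b} is the leg length of the hook.

betaSet : List ℕ → List ℕ
betaSet λ′ = go λ′ (length λ′)
  where
  go : List ℕ → ℕ → List ℕ
  go []       _ = []
  go (x ∷ xs) k = (x + (k ∸ 1)) ∷ go xs (k ∸ 1)

countBetween : ℕ → ℕ → List ℕ → ℕ
countBetween lo hi []       = 0
countBetween lo hi (c ∷ cs) =
  (if (lo <ᵇ c) ∧ (c <ᵇ hi) then 1 else 0) + countBetween lo hi cs

signℤ : ℕ → ℤ
signℤ zero          = + 1
signℤ (suc zero)    = - (+ 1)
signℤ (suc (suc h)) = signℤ h

replace : ℕ → ℕ → List ℕ → List ℕ
replace b b′ = map (λ c → if c ≡ᵇ b then b′ else c)

mn : List ℕ → List ℕ → ℤ
mn β []      = + 1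
mn β (r ∷ ρ) = sumℤ (map term β)
  where
  term : ℕ → ℤ
  term b = if (r ≤ᵇ b) ∧ (if elemᵇ (b ∸ r) β then false else true)
           then signℤ (countBetween (b ∸ r) b β) ℤ.* mn (replace b (b ∸ r) β) ρ
           else + 0

χ : List ℕ → List ℕ → ℤ
χ λ′ ρ = mn (betaSet λ′) ρ

kron : ℕ → List ℕ → List ℕ → List ℕ → ℚ
kron n λ′ μ ν =
  (sumℤ (map (λ σ → let ρ = cycleType n σ in χ λ′ ρ ℤ.* χ μ ρ ℤ.* χ ν ρ) (Sym n))
    / (n !)) {{n !≢0}}

-- Murnaghan–Nakayama bounds each character: removing a rim hook moves one of the ℓ(λ) β-numbers, so
-- |χ^λ(σ)| ≤ ℓ(λ)^c(σ), where c(σ) is the number of cycles of σ. Hence, with k = ℓmr,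
-- g(λ,μ,ν) ≤ (1/n!) Σ_{σ ∈ S_n} k^c(σ). Every σ ∈ S_(n+1) arises from some τ ∈ S_n by inserting n after
-- one of 0,…,n-1 in its cycle (same number of cycles) or as a new fixed point (one more cycle), so the sum
-- is at most k(k+1)⋯(k+n-1), which Bernoulli's inequality bounds by n!(n+1)^k.

module Submission where

open import Defs
open import Data.Nat using (ℕ; _*_; _^_; _≤_)
open import Data.List using (List; length)
open import Data.Product using (_×_; ∃-syntax)
open import Data.Integer using (+_)
import Data.Rational as ℚ

open import Data.Nat using (NonZero; _!; zero; suc; _+_; _∸_; _<_; z≤n; s≤s; z<s; s<s; _≟_; _≡ᵇ_; _≤ᵇ_)
open import Data.Nat.GeneralisedArithmetic using (iterate)
open import Data.Nat.Solver using (module +-*-Solver)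
open +-*-Solver using (solve; _:+_; _:*_; _:=_; con)
open import Data.Bool using (true; false; T; if_then_else_; _∧_)
open import Data.Nat.Properties
open import Data.Nat.ListAction using (sum)
open import Data.Nat.ListAction.Properties using (sum-++; sum-↭)
open import Data.List using ([]; _∷_; initLast; _∷ʳ′_; _++_; _∷ʳ_; map; concatMap; filter; upTo)
open import Data.List.Properties using (length-map; map-++; map-∘; length-++; length-upTo; upTo-∷ʳ; ++-identityʳ; ++-assoc; ∷-injectiveˡ; ∷-injectiveʳ; filter-accept; filter-reject; filter-all)
open import Data.List.Membership.Propositional using (_∈_; _∉_; find; lose)
open import Data.List.Membership.Propositional.Properties using (∈-∃++; ∈-map⁺; ∈-upTo⁺; ∈-upTo⁻; map∷⁻; ∈-concatMap⁺; ∈-concatMap⁻)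
open import Data.List.Relation.Binary.Subset.Propositional using (_⊆_)
open import Data.List.Relation.Binary.Permutation.Propositional using (_↭_; ↭⇒↭ₛ; prep; swap; ↭-refl; ↭-reflexive; ↭-sym; ↭-trans)
open import Data.List.Relation.Binary.Permutation.Propositional.Properties using (↭-empty-inv; ↭-length; ∷↭∷ʳ; ∈-resp-↭; shift; drop-mid)
import Data.List.Relation.Binary.Permutation.Propositional.Properties as ↭
import Data.List.Relation.Binary.Permutation.Setoid.Properties as ↭ₛ
open import Data.List.Relation.Unary.All using ([]; _∷_; universal) renaming (lookup to All-lookup)
import Data.List.Relation.Unary.All.Properties as All
open import Data.List.Relation.Unary.Any using (Any; here; there)
open import Data.List.Relation.Unary.Unique.Propositional using (Unique; []; _∷_)
import Data.List.Relation.Unary.Unique.Propositional.Properties as Unique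
open import Data.Integer using (ℤ; -[1+_]; ∣_∣)
import Data.Integer as ℤ
import Data.Integer.Properties as ℤ
import Data.Rational.Properties as ℚ
import Data.Rational.Unnormalised as ℚᵘ
import Data.Rational.Unnormalised.Properties as ℚᵘ
open import Data.Product using (_,_)
open import Function using (_∘_)
open import Relation.Binary.Definitions using (tri<; tri≈; tri>)
open import Relation.Nullary using (¬_; ¬?; Dec; yes; no; contradiction)
open import Relation.Binary.PropositionalEquality using (_≡_; _≢_; refl; sym; trans; cong; cong₂; subst; subst₂; setoid; module ≡-Reasoning)

private
  variable
    A B : Set

sum-map-++ : ∀ (f : A → ℕ) xs ys → sum (map f (xs ++ ys)) ≡ sum (map f xs) + sum (map f ys)
sum-map-++ f xs ys = trans (cong sum (map-++ f xs ys)) (sum-++ (map f xs) (map f ys))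

sum-map-mono : ∀ {f g : A → ℕ} xs → (∀ {x} → x ∈ xs → f x ≤ g x) → sum (map f xs) ≤ sum (map g xs)
sum-map-mono []       f≤g = z≤n
sum-map-mono (x ∷ xs) f≤g = +-mono-≤ (f≤g (here refl)) (sum-map-mono xs (f≤g ∘ there))

sum-map-≤-length* : ∀ {f : A → ℕ} {c} xs → (∀ {x} → x ∈ xs → f x ≤ c) → sum (map f xs) ≤ length xs * c
sum-map-≤-length* []       f≤c = z≤n
sum-map-≤-length* (x ∷ xs) f≤c = +-mono-≤ (f≤c (here refl)) (sum-map-≤-length* xs (f≤c ∘ there))

sum-map-*ˡ : ∀ c (f : A → ℕ) xs → sum (map (λ x → c * f x) xs) ≡ c * sum (map f xs)
sum-map-*ˡ c f []       = sym (*-zeroʳ c)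
sum-map-*ˡ c f (x ∷ xs) = trans (cong (_+_ (c * f x)) (sum-map-*ˡ c f xs)) (sym (*-distribˡ-+ c (f x) _))

sum-map-concatMap : ∀ (f : B → ℕ) (F : A → List B) xs →
                    sum (map f (concatMap F xs)) ≡ sum (map (λ a → sum (map f (F a))) xs)
sum-map-concatMap f F []       = refl
sum-map-concatMap f F (a ∷ xs) =
  trans (sum-map-++ f (F a) (concatMap F xs)) (cong (_+_ (sum (map f (F a)))) (sum-map-concatMap f F xs))

sum-map-⊆ : ∀ (f : A → ℕ) {xs ys} → Unique xs → xs ⊆ ys → sum (map f xs) ≤ sum (map f ys)
sum-map-⊆ f {[]}     _              _     = z≤n
sum-map-⊆ f {x ∷ xs} (x∉xs ∷ xs-unique) xs⊆ys with ∈-∃++ (xs⊆ys (here refl))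
... | as , bs , refl = begin
  f x + sum (map f xs)          ≤⟨ +-monoʳ-≤ (f x) (sum-map-⊆ f xs-unique xs⊆as++bs) ⟩
  f x + sum (map f (as ++ bs))  ≡⟨ sum-↭ (↭.map⁺ f (shift x as bs)) ⟨
  sum (map f (as ++ x ∷ bs))    ∎
  where
  open ≤-Reasoning
  xs⊆as++bs : xs ⊆ as ++ bs
  xs⊆as++bs y∈xs with ∈-resp-↭ (shift x as bs) (xs⊆ys (there y∈xs))
  ... | here y≡x  = contradiction (sym y≡x) (All-lookup x∉xs y∈xs)
  ... | there y∈ = y∈

∣sumℤ∣≤sum : ∀ (t : A → ℤ) (w : A → ℕ) xs → (∀ x → ∣ t x ∣ ≤ w x) → ∣ sumℤ (map t xs) ∣ ≤ sum (map w xs)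
∣sumℤ∣≤sum t w []       _   = z≤n
∣sumℤ∣≤sum t w (x ∷ xs) t≤w = ≤-trans (ℤ.∣i+j∣≤∣i∣+∣j∣ (t x) _) (+-mono-≤ (t≤w x) (∣sumℤ∣≤sum t w xs t≤w))

∈-insertions⁻ : ∀ {x : ℕ} ys {u} → u ∈ insertions x ys → u ↭ x ∷ ys
∈-insertions⁻ []       (here refl) = ↭-refl
∈-insertions⁻ (y ∷ ys) (here refl) = ↭-refl
∈-insertions⁻ {x = x} (y ∷ ys) (there u∈) with map∷⁻ u∈
... | v , v∈ , refl = ↭-trans (prep y (∈-insertions⁻ ys v∈)) (swap y x ↭-refl)

∈-insertions⁺ : ∀ (x : ℕ) as bs → as ++ x ∷ bs ∈ insertions x (as ++ bs)
∈-insertions⁺ x []       []       = here refl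
∈-insertions⁺ x []       (b ∷ bs) = here refl
∈-insertions⁺ x (a ∷ as) bs       = there (∈-map⁺ (a ∷_) (∈-insertions⁺ x as bs))

∈-perms⁻ : ∀ (xs : List ℕ) {σ} → σ ∈ perms xs → σ ↭ xs
∈-perms⁻ []       (here refl) = ↭-refl
∈-perms⁻ (x ∷ xs) σ∈ with find (∈-concatMap⁻ (insertions x) σ∈)
... | τ , τ∈ , σ∈τ = ↭-trans (∈-insertions⁻ τ σ∈τ) (prep x (∈-perms⁻ xs τ∈))

∈-perms⁺ : ∀ (xs : List ℕ) {σ} → σ ↭ xs → σ ∈ perms xs
∈-perms⁺ []       σ↭[] rewrite ↭-empty-inv σ↭[] = here refl
∈-perms⁺ (x ∷ xs) σ↭x∷xs with ∈-∃++ (∈-resp-↭ (↭-sym σ↭x∷xs) (here refl))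
... | as , bs , refl = ∈-concatMap⁺ (insertions x)
  (lose (∈-perms⁺ xs (drop-mid as [] σ↭x∷xs)) (∈-insertions⁺ x as bs))

insertions-unique : ∀ {x : ℕ} ys → x ∉ ys → Unique (insertions x ys)
insertions-unique []       _    = [] ∷ []
insertions-unique (y ∷ ys) x∉ys =
  All.map⁺ (universal (λ _ eq → x∉ys (here (∷-injectiveˡ eq))) _)
  ∷ Unique.map⁺ ∷-injectiveʳ (insertions-unique ys (x∉ys ∘ there))

Unique-concatMap⁺ : ∀ {f : A → List B} (r : B → A) {xs} →
                    (∀ {a u} → a ∈ xs → u ∈ f a → r u ≡ a) →
                    Unique xs → (∀ {a} → a ∈ xs → Unique (f a)) → Unique (concatMap f xs)
Unique-concatMap⁺ r {[]}     _   _              _  = []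
Unique-concatMap⁺ {f = f} r {a ∷ xs} r-inv (a∉xs ∷ xs-unique) !f =
  Unique.++⁺ (!f (here refl)) (Unique-concatMap⁺ r (λ a∈ → r-inv (there a∈)) xs-unique (λ a∈ → !f (there a∈))) disjoint
  where
  disjoint : ∀ {u} → ¬ (u ∈ f a × u ∈ concatMap f xs)
  disjoint (u∈fa , u∈fxs) with find (∈-concatMap⁻ f u∈fxs)
  ... | b , b∈xs , u∈fb = All-lookup a∉xs b∈xs (trans (sym (r-inv (here refl) u∈fa)) (r-inv (there b∈xs) u∈fb))

_≢?_ : (x y : ℕ) → Dec (x ≢ y)
x ≢? y = ¬? (x ≟ y)

removeAll : ℕ → List ℕ → List ℕ
removeAll x = filter (x ≢?_)

removeAll-insertions : ∀ {x} ys {u} → x ∉ ys → u ∈ insertions x ys → removeAll x u ≡ ys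
removeAll-insertions {x} []       _    (here refl) = filter-reject (x ≢?_) (λ x≢x → x≢x refl)
removeAll-insertions {x} (y ∷ ys) x∉ys (here refl) =
  trans (filter-reject (x ≢?_) (λ x≢x → x≢x refl)) (filter-all (x ≢?_) (All.¬Any⇒All¬ (y ∷ ys) x∉ys))
removeAll-insertions {x} (y ∷ ys) x∉ys (there u∈) with map∷⁻ u∈
... | v , v∈ , refl =
  trans (filter-accept (x ≢?_) (x∉ys ∘ here)) (cong (y ∷_) (removeAll-insertions ys (x∉ys ∘ there) v∈))

perms-unique : ∀ xs → Unique xs → Unique (perms xs)
perms-unique []       _             = [] ∷ []
perms-unique (x ∷ xs) (x∉xs ∷ xs-unique) =
  Unique-concatMap⁺ (removeAll x) (λ τ∈ → removeAll-insertions _ (x∉ τ∈)) (perms-unique xs xs-unique)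
    (λ τ∈ → insertions-unique _ (x∉ τ∈))
  where
  x∉ : ∀ {τ} → τ ∈ perms xs → x ∉ τ
  x∉ τ∈ x∈τ = All-lookup x∉xs (∈-resp-↭ (∈-perms⁻ xs τ∈) x∈τ) refl

Sym-unique : ∀ n → Unique (Sym n)
Sym-unique n = perms-unique (upTo n) (Unique.upTo⁺ n)

setAt : List ℕ → ℕ → ℕ → List ℕ
setAt []       j       y = []
setAt (x ∷ xs) zero    y = y ∷ xs
setAt (x ∷ xs) (suc j) y = x ∷ setAt xs j y

length-setAt : ∀ xs j y → length (setAt xs j y) ≡ length xs
length-setAt []       j       y = refl
length-setAt (x ∷ xs) zero    y = refl
length-setAt (x ∷ xs) (suc j) y = cong suc (length-setAt xs j y)

at-setAt-≡ : ∀ xs {j} y → j < length xs → at (setAt xs j y) j ≡ y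
at-setAt-≡ (x ∷ xs) {zero}  y _         = refl
at-setAt-≡ (x ∷ xs) {suc j} y (s≤s j<) = at-setAt-≡ xs y j<

at-setAt-≢ : ∀ xs {j x} y → x ≢ j → at (setAt xs j y) x ≡ at xs x
at-setAt-≢ []       {j}     {x}     y x≢j = refl
at-setAt-≢ (_ ∷ xs) {zero}  {zero}  y x≢j = contradiction refl x≢j
at-setAt-≢ (_ ∷ xs) {zero}  {suc x} y x≢j = refl
at-setAt-≢ (_ ∷ xs) {suc j} {zero}  y x≢j = refl
at-setAt-≢ (_ ∷ xs) {suc j} {suc x} y x≢j = at-setAt-≢ xs y (x≢j ∘ cong suc)

setAt-≥ : ∀ xs {j} y → length xs ≤ j → setAt xs j y ≡ xs
setAt-≥ []       y _          = refl
setAt-≥ (x ∷ xs) y (s≤s len≤) = cong (x ∷_) (setAt-≥ xs y len≤)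

setAt-length : ∀ as {v} bs y → setAt (as ++ v ∷ bs) (length as) y ≡ as ++ y ∷ bs
setAt-length []       bs y = refl
setAt-length (a ∷ as) bs y = cong (a ∷_) (setAt-length as bs y)

at-++ˡ : ∀ xs {ys x} → x < length xs → at (xs ++ ys) x ≡ at xs x
at-++ˡ (_ ∷ xs) {x = zero}  _        = refl
at-++ˡ (_ ∷ xs) {x = suc x} (s≤s x<) = at-++ˡ xs x<

at-++-length : ∀ xs {ys} → at (xs ++ ys) (length xs) ≡ at ys 0
at-++-length []       = refl
at-++-length (_ ∷ xs) = at-++-length xs

at-∈ : ∀ xs {x} → x < length xs → at xs x ∈ xs
at-∈ (_ ∷ xs) {zero}  _        = here refl
at-∈ (_ ∷ xs) {suc x} (s≤s x<) = there (at-∈ xs x<)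

at-injective : ∀ {xs} → Unique xs → ∀ {a b} → a < length xs → b < length xs → at xs a ≡ at xs b → a ≡ b
at-injective {_ ∷ xs} _            {zero}  {zero}  _        _        _  = refl
at-injective {_ ∷ xs} (x∉xs ∷ _)   {zero}  {suc b} _        (s≤s b<) eq = contradiction eq (All-lookup x∉xs (at-∈ xs b<))
at-injective {_ ∷ xs} (x∉xs ∷ _)   {suc a} {zero}  (s≤s a<) _        eq = contradiction (sym eq) (All-lookup x∉xs (at-∈ xs a<))
at-injective {_ ∷ xs} (_ ∷ xs-unique)    {suc a} {suc b} (s≤s a<) (s≤s b<) eq = cong suc (at-injective xs-unique a< b< eq)

module _ {n : ℕ} {σ : List ℕ} (σ∈ : σ ∈ Sym n) where

  private
    σ↭ : σ ↭ upTo n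
    σ↭ = ∈-perms⁻ (upTo n) σ∈

  length-Sym : length σ ≡ n
  length-Sym = trans (↭-length σ↭) (length-upTo n)

  at-Sym-< : ∀ {x} → x < n → at σ x < n
  at-Sym-< x<n = ∈-upTo⁻ (∈-resp-↭ σ↭ (at-∈ σ (subst (_ <_) (sym length-Sym) x<n)))

  at-Sym-injective : ∀ {x y} → x < n → y < n → at σ x ≡ at σ y → x ≡ y
  at-Sym-injective x<n y<n =
    at-injective (↭ₛ.Unique-resp-↭ (setoid ℕ) (↭⇒↭ₛ (↭-sym σ↭)) (Unique.upTo⁺ n))
      (subst (_ <_) (sym length-Sym) x<n) (subst (_ <_) (sym length-Sym) y<n)

-- In one-line notation: for τ ∈ S_n and j < n, cycleInsert n j τ ∈ S_(n+1) is τ with n inserted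
-- right after j in its cycle; cycleInsert n n τ is τ extended by the fixed point n.
cycleInsert : ℕ → ℕ → List ℕ → List ℕ
cycleInsert n j τ = setAt τ j n ∷ʳ at (τ ∷ʳ n) j

module _ {n : ℕ} {τ : List ℕ} (length-τ : length τ ≡ n) where

  private
    <length-τ : ∀ {x} → x < n → x < length τ
    <length-τ = subst (_ <_) (sym length-τ)

    <length-setAt : ∀ {j x} → x < n → x < length (setAt τ j n)
    <length-setAt {j} = subst (_ <_) (sym (trans (length-setAt τ j n) length-τ))

  at-cycleInsert-≢ : ∀ {j x} → x < n → x ≢ j → at (cycleInsert n j τ) x ≡ at τ x
  at-cycleInsert-≢ {j} x<n x≢j = trans (at-++ˡ (setAt τ j n) (<length-setAt x<n)) (at-setAt-≢ τ n x≢j)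

  at-cycleInsert-j : ∀ {j} → j < n → at (cycleInsert n j τ) j ≡ n
  at-cycleInsert-j {j} j<n = trans (at-++ˡ (setAt τ j n) (<length-setAt j<n)) (at-setAt-≡ τ n (<length-τ j<n))

  at-cycleInsert-n : ∀ {j} → j < n → at (cycleInsert n j τ) n ≡ at τ j
  at-cycleInsert-n {j} j<n = begin
    at (setAt τ j n ∷ʳ at (τ ∷ʳ n) j) n                       ≡⟨ cong (at (setAt τ j n ∷ʳ _)) length-setAt≡n ⟨
    at (setAt τ j n ∷ʳ at (τ ∷ʳ n) j) (length (setAt τ j n))  ≡⟨ at-++-length (setAt τ j n) ⟩
    at (τ ∷ʳ n) j                                             ≡⟨ at-++ˡ τ (<length-τ j<n) ⟩
    at τ j                                                    ∎
    where
    open ≡-Reasoning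
    length-setAt≡n : length (setAt τ j n) ≡ n
    length-setAt≡n = trans (length-setAt τ j n) length-τ

Sym-suc-remove : ∀ n as bs → as ++ n ∷ bs ∈ Sym (suc n) → as ++ bs ↭ upTo n
Sym-suc-remove n as bs σ∈ = ↭-trans (drop-mid as (upTo n) σ↭) (↭-reflexive (++-identityʳ (upTo n)))
  where
  σ↭ : as ++ n ∷ bs ↭ upTo n ∷ʳ n
  σ↭ = subst (as ++ n ∷ bs ↭_) (sym (upTo-∷ʳ n)) (∈-perms⁻ (upTo (suc n)) σ∈)

Sym-suc⁻ : ∀ n {σ} → σ ∈ Sym (suc n) → ∃[ τ ] ∃[ j ] τ ∈ Sym n × j < suc n × σ ≡ cycleInsert n j τ
Sym-suc⁻ n {σ} σ∈ with ∈-∃++ (∈-resp-↭ (↭-sym (∈-perms⁻ (upTo (suc n)) σ∈)) (∈-upTo⁺ (n<1+n n)))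
... | as , bs , refl with initLast bs
...   | [] = as , n , ∈-perms⁺ (upTo n) as↭ , n<1+n n , sym as∷ʳn≡
  where
  as↭ : as ↭ upTo n
  as↭ = subst (_↭ upTo n) (++-identityʳ as) (Sym-suc-remove n as [] σ∈)
  length-as : length as ≡ n
  length-as = trans (↭-length as↭) (length-upTo n)
  as∷ʳn≡ : cycleInsert n n as ≡ as ∷ʳ n
  as∷ʳn≡ = cong₂ _∷ʳ_ (setAt-≥ as n (≤-reflexive length-as))
                      (subst (λ k → at (as ∷ʳ n) k ≡ n) length-as (at-++-length as))
...   | bs′ ∷ʳ′ v = τ , length as , ∈-perms⁺ (upTo n) τ↭ , m≤n⇒m≤1+n length-as<n , σ≡
  where
  τ : List ℕ
  τ = as ++ v ∷ bs′
  τ↭ : τ ↭ upTo n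
  τ↭ = ↭-trans (↭.++⁺ˡ as (∷↭∷ʳ v bs′)) (Sym-suc-remove n as (bs′ ∷ʳ v) σ∈)
  length-as<n : length as < n
  length-as<n = subst (length as <_) (trans (sym (length-++ as)) (trans (↭-length τ↭) (length-upTo n)))
                      (m<m+n (length as) z<s)
  at-τ∷ʳn : at (τ ∷ʳ n) (length as) ≡ v
  at-τ∷ʳn = trans (cong (λ xs → at xs (length as)) (++-assoc as (v ∷ bs′) (n ∷ []))) (at-++-length as)
  σ≡ : as ++ n ∷ (bs′ ∷ʳ v) ≡ cycleInsert n (length as) τ
  σ≡ = begin
    as ++ n ∷ (bs′ ∷ʳ v)         ≡⟨ ++-assoc as (n ∷ bs′) (v ∷ []) ⟨
    (as ++ n ∷ bs′) ∷ʳ v         ≡⟨ cong₂ _∷ʳ_ (setAt-length as bs′ n) at-τ∷ʳn ⟨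
    cycleInsert n (length as) τ  ∎
    where open ≡-Reasoning

extensions : ℕ → List ℕ → List (List ℕ)
extensions n τ = map (λ j → cycleInsert n j τ) (upTo (suc n))

Sym-suc-⊆ : ∀ n → Sym (suc n) ⊆ concatMap (extensions n) (Sym n)
Sym-suc-⊆ n σ∈ with Sym-suc⁻ n σ∈
... | τ , j , τ∈ , j<1+n , refl =
  ∈-concatMap⁺ (extensions n) (lose τ∈ (∈-map⁺ (λ j → cycleInsert n j τ) (∈-upTo⁺ j<1+n)))

iterate-+ : ∀ (f : ℕ → ℕ) x m w → iterate f x (m + w) ≡ iterate f (iterate f x m) w
iterate-+ f x zero    w = refl
iterate-+ f x (suc m) w = iterate-+ f (f x) m w

iterate-suc : ∀ (f : ℕ → ℕ) x t → iterate f x (suc t) ≡ f (iterate f x t)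
iterate-suc f x zero    = refl
iterate-suc f x (suc t) = iterate-suc f (f x) t

-- cycleType n σ counts exactly the i < n for which DropsBelow (at σ) i n i fails.
DropsBelow : (ℕ → ℕ) → ℕ → ℕ → ℕ → Set
DropsBelow g i f c =
  ∃[ t ] t < f × iterate g c (suc t) < i × (∀ {u} → u < t → iterate g c (suc u) ≢ i)

allᵇ-≤ᵇ-false⁻ : ∀ i o → allᵇ (i ≤ᵇ_) o ≡ false → Any (_< i) o
allᵇ-≤ᵇ-false⁻ i (x ∷ o) all≡false with i ≤ᵇ x in i≤ᵇx
... | false = here (≰⇒> (λ i≤x → subst T i≤ᵇx (≤⇒≤ᵇ i≤x)))
... | true  = there (allᵇ-≤ᵇ-false⁻ i o all≡false)

allᵇ-≤ᵇ-false⁺ : ∀ i o → Any (_< i) o → allᵇ (i ≤ᵇ_) o ≡ false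
allᵇ-≤ᵇ-false⁺ i (x ∷ o) (here x<i) with i ≤ᵇ x in i≤ᵇx
... | false = refl
... | true  = contradiction (≤ᵇ⇒≤ i x (subst T (sym i≤ᵇx) _)) (<⇒≱ x<i)
allᵇ-≤ᵇ-false⁺ i (x ∷ o) (there x∈o) with i ≤ᵇ x
... | false = refl
... | true  = allᵇ-≤ᵇ-false⁺ i o x∈o

orbit-drops⁻ : ∀ σ i f c → Any (_< i) (orbit f σ i c) → DropsBelow (at σ) i f c
orbit-drops⁻ σ i (suc f) c (here σc<i) = 0 , z<s , σc<i , λ ()
orbit-drops⁻ σ i (suc f) c (there p) with at σ c ≡ᵇ i in σc≡ᵇi
... | false with orbit-drops⁻ σ i f (at σ c) p
...   | t , t<f , below , noReturn = suc t , s<s t<f , below , noReturn′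
  where
  noReturn′ : ∀ {u} → u < suc t → iterate (at σ) c (suc u) ≢ i
  noReturn′ {zero}  _         σc≡i = subst T σc≡ᵇi (≡⇒≡ᵇ _ _ σc≡i)
  noReturn′ {suc u} (s<s u<t)      = noReturn u<t

orbit-drops⁺ : ∀ σ i f c → DropsBelow (at σ) i f c → Any (_< i) (orbit f σ i c)
orbit-drops⁺ σ i (suc f) c (zero  , _ , below , _) = here below
orbit-drops⁺ σ i (suc f) c (suc t , s<s t<f , below , noReturn) with at σ c ≡ᵇ i in σc≡ᵇi
... | false = there (orbit-drops⁺ σ i f (at σ c) (t , t<f , below , λ u<t → noReturn (s<s u<t)))
... | true  = contradiction (≡ᵇ⇒≡ _ _ (subst T (sym σc≡ᵇi) _)) (noReturn z<s)

module CycleInsertion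
  {n j : ℕ} {g h : ℕ → ℕ}
  (g-< : ∀ {x} → x < n → g x < n)
  (g-injective : ∀ {x y} → x < n → y < n → g x ≡ g y → x ≡ y)
  (h-≢ : ∀ {x} → x < n → x ≢ j → h x ≡ g x)
  (h-j : j < n → h j ≡ n)
  (h-n : j < n → h n ≡ g j)
  where

  iterate-< : ∀ {c} t → c < n → iterate g c t < n
  iterate-< zero    c<n = c<n
  iterate-< (suc t) c<n = iterate-< t (g-< c<n)

  iterate-agree : ∀ {c} u → c < n → (∀ {v} → v < u → iterate g c v ≢ j) → iterate h c u ≡ iterate g c u
  iterate-agree zero    _   _       = refl
  iterate-agree (suc u) c<n avoid-j rewrite h-≢ c<n (avoid-j z<s) =
    iterate-agree u (g-< c<n) (λ v<u → avoid-j (s<s v<u))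

  iterate-cancel : ∀ {c} a e → c < n → iterate g c a ≡ iterate g c (a + e) → c ≡ iterate g c e
  iterate-cancel         zero    e c<n eq = eq
  iterate-cancel {c = c} (suc a) e c<n eq =
    g-injective c<n (iterate-< e c<n) (trans (iterate-cancel a e (g-< c<n) eq) (iterate-suc g c e))

  module _ {i t : ℕ} (i<n : i < n) (noReturn : ∀ {u} → u < t → iterate g i (suc u) ≢ i) where

    -- Cancelling x applications of the injective g would give a return to i after y ∸ x ≤ t steps.
    no-revisit : ∀ {x y} → x < y → y ≤ t → iterate g i x ≢ iterate g i y
    no-revisit {x} {y} x<y y≤t g^x≡g^y =
      noReturn e<t (sym (iterate-cancel x (suc e) i<n (trans g^x≡g^y (cong (iterate g i) (sym x+1+e≡y)))))
      where
      e : ℕ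
      e = y ∸ suc x
      x+1+e≡y : x + suc e ≡ y
      x+1+e≡y = trans (+-suc x e) (m+[n∸m]≡n x<y)
      e<t : e < t
      e<t = ≤-trans (m≤n+m (suc e) x) (subst (_≤ t) (sym x+1+e≡y) y≤t)

    visits-j-once : ∀ {a b} → a ≤ t → b ≤ t → iterate g i a ≡ j → iterate g i b ≡ j → a ≡ b
    visits-j-once {a} {b} a≤t b≤t g^a≡j g^b≡j with <-cmp a b
    ... | tri≈ _ a≡b _ = a≡b
    ... | tri< a<b _ _ = contradiction (trans g^a≡j (sym g^b≡j)) (no-revisit a<b b≤t)
    ... | tri> _ _ b<a = contradiction (trans g^b≡j (sym g^a≡j)) (no-revisit b<a a≤t)

    -- The h-orbit of i follows the g-orbit, with one extra step through n right after j.
    module Detour {a : ℕ} (a≤t : a ≤ t) (g^a≡j : iterate g i a ≡ j) where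

      avoids-j : ∀ {v} → v ≤ t → v ≢ a → iterate g i v ≢ j
      avoids-j v≤t v≢a g^v≡j = v≢a (visits-j-once v≤t a≤t g^v≡j g^a≡j)

      j<n : j < n
      j<n = subst (_< n) g^a≡j (iterate-< a i<n)

      h-before : ∀ {u} → u ≤ a → iterate h i u ≡ iterate g i u
      h-before {u} u≤a = iterate-agree u i<n (λ v<u → avoids-j (≤-trans (<⇒≤ v<u) (≤-trans u≤a a≤t)) (<⇒≢ (<-≤-trans v<u u≤a)))

      h-at-n : iterate h i (suc a) ≡ n
      h-at-n = begin
        iterate h i (suc a)  ≡⟨ iterate-suc h i a ⟩
        h (iterate h i a)    ≡⟨ cong h (trans (h-before ≤-refl) g^a≡j) ⟩
        h j                  ≡⟨ h-j j<n ⟩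
        n                    ∎
        where open ≡-Reasoning

      h-after : ∀ w → a + w ≤ t → iterate h i (suc (suc (a + w))) ≡ iterate g i (suc (a + w))
      h-after w a+w≤t = begin
        iterate h i (suc (suc a) + w)             ≡⟨ iterate-+ h i (suc (suc a)) w ⟩
        iterate h (iterate h i (suc (suc a))) w   ≡⟨ cong (λ c → iterate h c w) h-2+a ⟩
        iterate h (iterate g i (suc a)) w         ≡⟨ iterate-agree w (iterate-< (suc a) i<n) avoid ⟩
        iterate g (iterate g i (suc a)) w         ≡⟨ iterate-+ g i (suc a) w ⟨
        iterate g i (suc a + w)                   ∎
        where
        open ≡-Reasoning
        h-2+a : iterate h i (suc (suc a)) ≡ iterate g i (suc a)
        h-2+a = begin
          iterate h i (suc (suc a))  ≡⟨ iterate-suc h i (suc a) ⟩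
          h (iterate h i (suc a))    ≡⟨ cong h h-at-n ⟩
          h n                        ≡⟨ h-n j<n ⟩
          g j                        ≡⟨ cong g g^a≡j ⟨
          g (iterate g i a)          ≡⟨ iterate-suc g i a ⟨
          iterate g i (suc a)        ∎
        avoid : ∀ {v} → v < w → iterate g (iterate g i (suc a)) v ≢ j
        avoid {v} v<w = subst (_≢ j) (iterate-+ g i (suc a) v)
          (avoids-j (≤-trans (+-monoʳ-< a v<w) a+w≤t) (λ 1+a+v≡a → m≢1+m+n a (sym 1+a+v≡a)))

      h-below : iterate g i (suc t) < i → iterate h i (suc (suc t)) < i
      h-below = subst (_< i) (sym h-2+t)
        where
        h-2+t : iterate h i (suc (suc t)) ≡ iterate g i (suc t)
        h-2+t = subst (λ s → iterate h i (suc (suc s)) ≡ iterate g i (suc s)) (m+[n∸m]≡n a≤t)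
                      (h-after (t ∸ a) (≤-reflexive (m+[n∸m]≡n a≤t)))

      h-noReturn : ∀ {u} → u ≤ t → iterate h i (suc u) ≢ i
      h-noReturn {u} u≤t with <-cmp u a
      ... | tri< u<a _ _ = subst (_≢ i) (sym (h-before u<a)) (noReturn (<-≤-trans u<a a≤t))
      ... | tri≈ _ refl _ = subst (_≢ i) (sym h-at-n) (λ n≡i → <⇒≢ i<n (sym n≡i))
      ... | tri> _ _ a<u = subst (_≢ i) (sym h-u) (noReturn (subst (_≤ t) (sym 1+a+w≡u) u≤t))
        where
        w : ℕ
        w = u ∸ suc a
        1+a+w≡u : suc (a + w) ≡ u
        1+a+w≡u = m+[n∸m]≡n a<u
        h-u : iterate h i (suc u) ≡ iterate g i (suc (a + w))
        h-u = subst (λ s → iterate h i (suc s) ≡ iterate g i (suc (a + w))) 1+a+w≡u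
                    (h-after w (<⇒≤ (subst (_≤ t) (sym 1+a+w≡u) u≤t)))

  dropsBelow : ∀ {i f} → i < n → DropsBelow g i f i → DropsBelow h i (suc f) i
  dropsBelow {i} i<n (t , t<f , below , noReturn) with anyUpTo? (λ a → iterate g i a ≟ j) (suc t)
  ... | yes (a , a<1+t , g^a≡j) = suc t , s<s t<f , h-below below , λ u<1+t → h-noReturn (≤-pred u<1+t)
    where open Detour i<n noReturn (≤-pred a<1+t) g^a≡j
  ... | no never-j = t , m<n⇒m<1+n t<f , subst (_< i) (sym (agree ≤-refl)) below ,
                     λ u<t → subst (_≢ i) (sym (agree (s≤s (<⇒≤ u<t)))) (noReturn u<t)
    where
    agree : ∀ {u} → u ≤ suc t → iterate h i u ≡ iterate g i u
    agree {u} u≤1+t = iterate-agree u i<n (λ {v} v<u g^v≡j → never-j (v , <-≤-trans v<u u≤1+t , g^v≡j))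

isCycleMin : ℕ → List ℕ → ℕ → ℕ
isCycleMin n σ i = if allᵇ (i ≤ᵇ_) (orbit n σ i i) then 1 else 0

length-cycleType : ∀ n σ → length (cycleType n σ) ≡ sum (map (isCycleMin n σ) (upTo n))
length-cycleType n σ = go (upTo n)
  where
  -- The lambda is cycleType's local function cyc, which is not in scope.
  go : ∀ xs → length (concatMap (λ i → if allᵇ (i ≤ᵇ_) (orbit n σ i i) then length (orbit n σ i i) ∷ [] else []) xs)
              ≡ sum (map (isCycleMin n σ) xs)
  go []       = refl
  go (i ∷ xs) with allᵇ (i ≤ᵇ_) (orbit n σ i i)
  ... | true  = cong suc (go xs)
  ... | false = go xs

if-≤1 : ∀ b → (if b then 1 else 0) ≤ 1
if-≤1 true  = ≤-refl
if-≤1 false = z≤n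

if-mono : ∀ {b c} → (c ≡ false → b ≡ false) → (if b then 1 else 0) ≤ (if c then 1 else 0)
if-mono {b} {true}  _   = if-≤1 b
if-mono {b} {false} c⇒b rewrite c⇒b refl = z≤n

isCycleMin-drops : ∀ {n σ i} → DropsBelow (at σ) i n i → isCycleMin n σ i ≡ 0
isCycleMin-drops {n} {σ} {i} drops = cong (λ b → if b then 1 else 0) (allᵇ-≤ᵇ-false⁺ i _ (orbit-drops⁺ σ i n i drops))

isCycleMin-mono : ∀ {n σ m τ i} → (DropsBelow (at τ) i n i → DropsBelow (at σ) i m i) →
                  isCycleMin m σ i ≤ isCycleMin n τ i
isCycleMin-mono {n} {σ} {m} {τ} {i} drops =
  if-mono (λ τ-false → allᵇ-≤ᵇ-false⁺ i _ (orbit-drops⁺ σ i m i (drops (orbit-drops⁻ τ i n i (allᵇ-≤ᵇ-false⁻ i _ τ-false)))))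

module _ {n j : ℕ} {τ : List ℕ} (τ∈ : τ ∈ Sym n) where

  private
    σ : List ℕ
    σ = cycleInsert n j τ
    length-τ : length τ ≡ n
    length-τ = length-Sym τ∈

  open CycleInsertion {n} {j} {at τ} {at σ} (at-Sym-< τ∈) (at-Sym-injective τ∈) (at-cycleInsert-≢ {τ = τ} length-τ)
                      (at-cycleInsert-j {τ = τ} length-τ) (at-cycleInsert-n {τ = τ} length-τ)

  cycles-cycleInsert : length (cycleType (suc n) σ) ≤ isCycleMin (suc n) σ n + length (cycleType n τ)
  cycles-cycleInsert = begin
    length (cycleType (suc n) σ)                          ≡⟨ length-cycleType (suc n) σ ⟩
    sum (map (isCycleMin (suc n) σ) (upTo (suc n)))       ≡⟨ cong (sum ∘ map (isCycleMin (suc n) σ)) (upTo-∷ʳ n) ⟨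
    sum (map (isCycleMin (suc n) σ) (upTo n ∷ʳ n))        ≡⟨ sum-map-++ (isCycleMin (suc n) σ) (upTo n) (n ∷ []) ⟩
    sum (map (isCycleMin (suc n) σ) (upTo n)) + (isCycleMin (suc n) σ n + 0)
      ≤⟨ +-mono-≤ (sum-map-mono (upTo n) (λ i∈ → isCycleMin-mono {n} {σ} {suc n} {τ} (dropsBelow (∈-upTo⁻ i∈))))
                  (≤-reflexive (+-identityʳ _)) ⟩
    sum (map (isCycleMin n τ) (upTo n)) + isCycleMin (suc n) σ n  ≡⟨ +-comm _ (isCycleMin (suc n) σ n) ⟩
    isCycleMin (suc n) σ n + sum (map (isCycleMin n τ) (upTo n))  ≡⟨ cong (_+_ (isCycleMin (suc n) σ n)) (length-cycleType n τ) ⟨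
    isCycleMin (suc n) σ n + length (cycleType n τ)       ∎
    where open ≤-Reasoning

  isCycleMin-cycleInsert-n : j < n → isCycleMin (suc n) σ n ≡ 0
  isCycleMin-cycleInsert-n j<n =
    isCycleMin-drops {suc n} {σ} (0 , z<s , subst (_< n) (sym (at-cycleInsert-n {τ = τ} length-τ j<n)) (at-Sym-< τ∈ j<n) , λ ())

cyclePowerSum : ℕ → ℕ → ℕ
cyclePowerSum K n = sum (map (λ σ → K ^ length (cycleType n σ)) (Sym n))

module _ (K : ℕ) .{{_ : NonZero K}} (n : ℕ) where

  private
    W : ℕ → List ℕ → ℕ
    W m σ = K ^ length (cycleType m σ)

  sum-extensions : ∀ {τ} → τ ∈ Sym n → sum (map (W (suc n)) (extensions n τ)) ≤ (K + n) * W n τ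
  sum-extensions {τ} τ∈ = begin
    sum (map (W (suc n)) (extensions n τ))  ≡⟨ cong sum (map-∘ (upTo (suc n))) ⟨
    sum (map w (upTo (suc n)))              ≡⟨ cong (sum ∘ map w) (upTo-∷ʳ n) ⟨
    sum (map w (upTo n ∷ʳ n))               ≡⟨ sum-map-++ w (upTo n) (n ∷ []) ⟩
    sum (map w (upTo n)) + (w n + 0)
      ≤⟨ +-mono-≤ (sum-map-≤-length* (upTo n) (w-< ∘ ∈-upTo⁻)) (≤-reflexive (+-identityʳ (w n))) ⟩
    length (upTo n) * W n τ + w n           ≤⟨ +-mono-≤ (≤-reflexive (cong (_* W n τ) (length-upTo n))) w-n ⟩
    n * W n τ + K * W n τ                   ≡⟨ trans (*-distribʳ-+ (W n τ) K n) (+-comm (K * W n τ) (n * W n τ)) ⟨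
    (K + n) * W n τ                         ∎
    where
    open ≤-Reasoning
    w : ℕ → ℕ
    w j = W (suc n) (cycleInsert n j τ)
    w-< : ∀ {j} → j < n → w j ≤ W n τ
    w-< {j} j<n = ^-monoʳ-≤ K (subst (λ m → length (cycleType (suc n) (cycleInsert n j τ)) ≤ m + length (cycleType n τ))
                                     (isCycleMin-cycleInsert-n {j = j} τ∈ j<n) (cycles-cycleInsert {j = j} τ∈))
    w-n : w n ≤ K * W n τ
    w-n = ^-monoʳ-≤ K (≤-trans (cycles-cycleInsert {j = n} τ∈) (+-monoˡ-≤ (length (cycleType n τ)) (if-≤1 _)))

  cyclePowerSum-suc : cyclePowerSum K (suc n) ≤ (K + n) * cyclePowerSum K n
  cyclePowerSum-suc = begin
    sum (map (W (suc n)) (Sym (suc n)))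
      ≤⟨ sum-map-⊆ (W (suc n)) (Sym-unique (suc n)) (Sym-suc-⊆ n) ⟩
    sum (map (W (suc n)) (concatMap (extensions n) (Sym n)))
      ≡⟨ sum-map-concatMap (W (suc n)) (extensions n) (Sym n) ⟩
    sum (map (λ τ → sum (map (W (suc n)) (extensions n τ))) (Sym n))
      ≤⟨ sum-map-mono (Sym n) sum-extensions ⟩
    sum (map (λ τ → (K + n) * W n τ) (Sym n))
      ≡⟨ sum-map-*ˡ (K + n) (W n) (Sym n) ⟩
    (K + n) * sum (map (W n) (Sym n))
      ∎
    where open ≤-Reasoning

bernoulli-step : ∀ a k X Y → X * (a + k) ≤ a * Y → a * X * (a + suc k) ≤ a * (suc a * Y)
bernoulli-step a k X Y ih = begin
  a * X * (a + suc k)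
    ≡⟨ solve 3 (λ a k X → a :* X :* (a :+ (con 1 :+ k)) := X :* (a :+ a :* (a :+ k))) refl a k X ⟩
  X * (a + a * (a + k))
    ≤⟨ *-monoʳ-≤ X (+-monoˡ-≤ (a * (a + k)) (m≤m+n a k)) ⟩
  X * (a + k + a * (a + k))
    ≡⟨ solve 3 (λ a k X → X :* (a :+ k :+ a :* (a :+ k)) := (con 1 :+ a) :* (X :* (a :+ k))) refl a k X ⟩
  suc a * (X * (a + k))
    ≤⟨ *-monoʳ-≤ (suc a) ih ⟩
  suc a * (a * Y)
    ≡⟨ solve 2 (λ a Y → (con 1 :+ a) :* (a :* Y) := a :* ((con 1 :+ a) :* Y)) refl a Y ⟩
  a * (suc a * Y)
    ∎
  where open ≤-Reasoning

bernoulli : ∀ a k → a ^ k * (a + k) ≤ a * suc a ^ k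
bernoulli a zero    = ≤-reflexive (trans (*-identityˡ (a + 0)) (trans (+-identityʳ a) (sym (*-identityʳ a))))
bernoulli a (suc k) = bernoulli-step a k (a ^ k) (suc a ^ k) (bernoulli a k)

rising-step : ∀ K n F X Y → X * (suc n + K) ≤ suc n * Y → (K + n) * (F * X) ≤ suc n * F * Y
rising-step K n F X Y XY = begin
  (K + n) * (F * X)      ≡⟨ solve 4 (λ K n F X → (K :+ n) :* (F :* X) := F :* (X :* (K :+ n))) refl K n F X ⟩
  F * (X * (K + n))      ≤⟨ *-monoʳ-≤ F (*-monoʳ-≤ X (≤-trans (≤-reflexive (+-comm K n)) (n≤1+n (n + K)))) ⟩
  F * (X * (suc n + K))  ≤⟨ *-monoʳ-≤ F XY ⟩
  F * (suc n * Y)        ≡⟨ solve 3 (λ n F Y → F :* ((con 1 :+ n) :* Y) := (con 1 :+ n) :* F :* Y) refl n F Y ⟩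
  suc n * F * Y          ∎
  where open ≤-Reasoning

cyclePowerSum-≤ : ∀ K .{{_ : NonZero K}} n → cyclePowerSum K n ≤ n ! * suc n ^ K
cyclePowerSum-≤ K zero    = ≤-reflexive (sym (trans (+-identityʳ (1 ^ K)) (^-zeroˡ K)))
cyclePowerSum-≤ K (suc n) = begin
  cyclePowerSum K (suc n)        ≤⟨ cyclePowerSum-suc K n ⟩
  (K + n) * cyclePowerSum K n    ≤⟨ *-monoʳ-≤ (K + n) (cyclePowerSum-≤ K n) ⟩
  (K + n) * (n ! * suc n ^ K)    ≤⟨ rising-step K n (n !) (suc n ^ K) (suc (suc n) ^ K) (bernoulli (suc n) K) ⟩
  suc n ! * suc (suc n) ^ K      ∎
  where open ≤-Reasoning

∣signℤ∣≡1 : ∀ h → ∣ signℤ h ∣ ≡ 1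
∣signℤ∣≡1 zero          = refl
∣signℤ∣≡1 (suc zero)    = refl
∣signℤ∣≡1 (suc (suc h)) = ∣signℤ∣≡1 h

∣mn∣≤ : ∀ β ρ → ∣ mn β ρ ∣ ≤ length β ^ length ρ
∣mn∣≤ β []      = ≤-refl
∣mn∣≤ β (r ∷ ρ) =
  ≤-trans (∣sumℤ∣≤sum _ (λ _ → length β ^ length ρ) β
                       (λ b → term≤ ((r ≤ᵇ b) ∧ (if elemᵇ (b ∸ r) β then false else true)) b))
          (sum-map-≤-length* β (λ _ → ≤-refl))
  where
  -- The summand of mn (its local function term, which is not in scope), with the rim-hook test abstracted to c.
  term≤ : ∀ c b → ∣ (if c then signℤ (countBetween (b ∸ r) b β) ℤ.* mn (replace b (b ∸ r) β) ρ else + 0) ∣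
                  ≤ length β ^ length ρ
  term≤ false b = z≤n
  term≤ true  b = begin
    ∣ signℤ h ℤ.* mn β′ ρ ∣       ≡⟨ ℤ.∣i*j∣≡∣i∣*∣j∣ (signℤ h) (mn β′ ρ) ⟩
    ∣ signℤ h ∣ * ∣ mn β′ ρ ∣     ≡⟨ cong (_* ∣ mn β′ ρ ∣) (∣signℤ∣≡1 h) ⟩
    1 * ∣ mn β′ ρ ∣               ≡⟨ *-identityˡ _ ⟩
    ∣ mn β′ ρ ∣                   ≤⟨ ∣mn∣≤ β′ ρ ⟩
    length β′ ^ length ρ          ≡⟨ cong (_^ length ρ) (length-map _ β) ⟩
    length β ^ length ρ           ∎
    where
    open ≤-Reasoning
    h : ℕ
    h = countBetween (b ∸ r) b β
    β′ : List ℕ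
    β′ = replace b (b ∸ r) β

mutual
  -- The local function go of betaSet is not in scope; the unifier recovers it from betaSet-∷,
  -- once the with-abstraction has made its arguments variables.
  betaSet-go : List ℕ → List ℕ → ℕ → List ℕ
  betaSet-go = _

  betaSet-∷ : ∀ x xs → betaSet (x ∷ xs) ≡ x + length xs ∷ betaSet-go (x ∷ xs) xs (length xs)
  betaSet-∷ x xs with x ∷ xs | length xs
  ... | _ | _ = refl

length-betaSet-go : ∀ λ′ ys k → length (betaSet-go λ′ ys k) ≡ length ys
length-betaSet-go λ′ []       k = refl
length-betaSet-go λ′ (y ∷ ys) k = cong suc (length-betaSet-go λ′ ys (k ∸ 1))

length-betaSet : ∀ λ′ → length (betaSet λ′) ≡ length λ′
length-betaSet []       = refl
length-betaSet (x ∷ xs) = trans (cong length (betaSet-∷ x xs)) (cong suc (length-betaSet-go (x ∷ xs) xs (length xs)))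

∣χ∣≤ : ∀ λ′ ρ → ∣ χ λ′ ρ ∣ ≤ length λ′ ^ length ρ
∣χ∣≤ λ′ ρ = subst (λ ℓ → ∣ χ λ′ ρ ∣ ≤ ℓ ^ length ρ) (length-betaSet λ′) (∣mn∣≤ (betaSet λ′) ρ)

^-distribʳ-* : ∀ m n k → (m * n) ^ k ≡ m ^ k * n ^ k
^-distribʳ-* m n zero    = refl
^-distribʳ-* m n (suc k) = trans (cong (m * n *_) (^-distribʳ-* m n k)) (interchange m n (m ^ k) (n ^ k))
  where
  interchange : ∀ a b c d → a * b * (c * d) ≡ a * c * (b * d)
  interchange = solve 4 (λ a b c d → a :* b :* (c :* d) := a :* c :* (b :* d)) refl

∣χχχ∣≤ : ∀ λ′ μ ν ρ → ∣ χ λ′ ρ ℤ.* χ μ ρ ℤ.* χ ν ρ ∣ ≤ (length λ′ * length μ * length ν) ^ length ρ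
∣χχχ∣≤ λ′ μ ν ρ = begin
  ∣ χ λ′ ρ ℤ.* χ μ ρ ℤ.* χ ν ρ ∣         ≡⟨ ℤ.∣i*j∣≡∣i∣*∣j∣ (χ λ′ ρ ℤ.* χ μ ρ) (χ ν ρ) ⟩
  ∣ χ λ′ ρ ℤ.* χ μ ρ ∣ * ∣ χ ν ρ ∣       ≡⟨ cong (_* ∣ χ ν ρ ∣) (ℤ.∣i*j∣≡∣i∣*∣j∣ (χ λ′ ρ) (χ μ ρ)) ⟩
  ∣ χ λ′ ρ ∣ * ∣ χ μ ρ ∣ * ∣ χ ν ρ ∣     ≤⟨ *-mono-≤ (*-mono-≤ (∣χ∣≤ λ′ ρ) (∣χ∣≤ μ ρ)) (∣χ∣≤ ν ρ) ⟩
  ℓ ^ c * m ^ c * r ^ c                  ≡⟨ cong (_* r ^ c) (^-distribʳ-* ℓ m c) ⟨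
  (ℓ * m) ^ c * r ^ c                    ≡⟨ ^-distribʳ-* (ℓ * m) r c ⟨
  (ℓ * m * r) ^ c                        ∎
  where
  open ≤-Reasoning
  ℓ m r c : ℕ
  ℓ = length λ′
  m = length μ
  r = length ν
  c = length ρ

∣i∣≤m⇒i≤m : ∀ {i m} → ∣ i ∣ ≤ m → i ℤ.≤ + m
∣i∣≤m⇒i≤m {+ n}        n≤m = ℤ.+≤+ n≤m
∣i∣≤m⇒i≤m { -[1+ n ] } _   = ℤ.-≤+

/-≤-/1 : ∀ (i : ℤ) d .{{_ : NonZero d}} m → i ℤ.≤ + (m * d) → i ℚ./ d ℚ.≤ + m ℚ./ 1
/-≤-/1 i (suc d) m i≤m*d =
  ℚ.toℚᵘ-cancel-≤ (ℚᵘ.≤-respˡ-≃ (ℚᵘ.≃-sym (ℚ.toℚᵘ-fromℚᵘ (ℚᵘ.mkℚᵘ i d)))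
                    (ℚᵘ.≤-respʳ-≃ (ℚᵘ.≃-sym (ℚ.toℚᵘ-fromℚᵘ (ℚᵘ.mkℚᵘ (+ m) 0)))
                      (ℚᵘ.*≤* (subst₂ ℤ._≤_ (sym (ℤ.*-identityʳ i)) (ℤ.pos-* m (suc d)) i≤m*d))))

length-nonZero : ∀ {n λ′} → IsPartition n λ′ → 1 ≤ n → NonZero (length λ′)
length-nonZero {λ′ = []}    (_ , _ , refl) ()
length-nonZero {λ′ = _ ∷ _} _              _  = _

kron-≤ : ∀ n λ′ μ ν → IsPartition n λ′ → IsPartition n μ → IsPartition n ν → 1 ≤ n →
         kron n λ′ μ ν ℚ.≤ + ((2 * n) ^ (length λ′ * length μ * length ν)) ℚ./ 1
kron-≤ n λ′ μ ν λ′⊢n μ⊢n ν⊢n 1≤n = /-≤-/1 S (n !) {{n !≢0}} ((2 * n) ^ k) (∣i∣≤m⇒i≤m (begin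
  ∣ S ∣                      ≤⟨ ∣sumℤ∣≤sum _ (λ σ → k ^ length (ρ σ)) (Sym n) (λ σ → ∣χχχ∣≤ λ′ μ ν (ρ σ)) ⟩
  cyclePowerSum k n          ≤⟨ cyclePowerSum-≤ k n ⟩
  n ! * suc n ^ k            ≤⟨ *-monoʳ-≤ (n !) (^-monoˡ-≤ k 1+n≤2n) ⟩
  n ! * (2 * n) ^ k          ≡⟨ *-comm (n !) _ ⟩
  (2 * n) ^ k * n !          ∎))
  where
  open ≤-Reasoning
  ρ : List ℕ → List ℕ
  ρ = cycleType n
  S : ℤ
  S = sumℤ (map (λ σ → χ λ′ (ρ σ) ℤ.* χ μ (ρ σ) ℤ.* χ ν (ρ σ)) (Sym n))
  k : ℕ
  k = length λ′ * length μ * length ν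
  instance
    ℓ≢0 : NonZero (length λ′)
    ℓ≢0 = length-nonZero λ′⊢n 1≤n
    m≢0 : NonZero (length μ)
    m≢0 = length-nonZero μ⊢n 1≤n
    r≢0 : NonZero (length ν)
    r≢0 = length-nonZero ν⊢n 1≤n
    k≢0 : NonZero k
    k≢0 = m*n≢0 (length λ′ * length μ) (length ν) {{m*n≢0 (length λ′) (length μ)}}
  1+n≤2n : suc n ≤ 2 * n
  1+n≤2n = ≤-trans (+-monoˡ-≤ n 1≤n) (≤-reflexive (cong (_+_ n) (sym (+-identityʳ n))))

corollary5p4 : ∃[ K ] ∃[ p ] ∃[ q ] ∃[ N ] (1 ≤ p) × (1 ≤ q) ×
                 ((n : ℕ) (λ′ μ ν : List ℕ) →
                  IsPartition n λ′ → IsPartition n μ → IsPartition n ν →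
                  N ≤ n →
                  q * (length λ′ * length μ * length ν) ≤ p * n →
                  kron n λ′ μ ν ℚ.≤
                    (+ ((K * n) ^ (length λ′ * length μ * length ν))) ℚ./ 1)
corollary5p4 = 2 , 1 , 1 , 1 , s≤s z≤n , s≤s z≤n , λ n λ′ μ ν λ′⊢n μ⊢n ν⊢n 1≤n _ → kron-≤ n λ′ μ ν λ′⊢n μ⊢n ν⊢n 1≤n
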